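{- Let $G$ be a connected graph with a parallelogram placement $\rho$ and a ribbon $r$ which is an edge cut. If the vertex set of (the edges of) $r$ is $V_1\cup V_2$, where all vertices of $V_i$ belong to the same connected component of $G\setminus r=(V_G,E_G\setminus r)$, then $\rho(V_2)$ is a translation of $\rho(V_1)$. In particular, the vector $\rho(u_2)-\rho(u_1)$ is the same for all edges $u_1u_2\in r$ with $u_1\in V_1$, $u_2\in V_2$.
   Context: For a graph $G$, two edges are related if they are opposite edges of a 4-cycle subgraph of $G$; a ribbon is an equivalence class of the reflexive–transitive closure of this relation. A set of edges $r$ is an edge cut of a connected graph $G$ if $(V_G,E_G\setminus r)$ is disconnected. A parallelogram placement of a connected graph $G$ is an injective map $\rho:V_G\to\mathbb{R}^2$ such that every 4-cycle $(u_1,u_2,u_3,u_4)$ of $G$ forms a parallelogram, i.e. $\rho(u_2)-\rho(u_1)=\rho(u_3)-\rho(u_4)$. -}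

module Defs where

open import Level using (Level; _⊔_) renaming (zero to lzero; suc to lsuc)
open import Data.Nat using (ℕ)
open import Data.Fin using (Fin)
open import Data.Product using (Σ; ∃; ∃-syntax; _×_; _,_)
open import Data.Sum using (_⊎_)
open import Relation.Nullary using (¬_)
open import Relation.Binary.PropositionalEquality using (_≡_)
open import Relation.Binary.Construct.Closure.ReflexiveTransitive using (Star)
open import Algebra.Bundles using (AbelianGroup)

-- An (undirected) edge {u,v} is represented
-- by either ordered pair (u , v) / (v , u) with Adj u v.
record Graph : Set₁ where
  field
    n      : ℕ
    Adj    : Fin n → Fin n → Set
    sym    : ∀ {u v} → Adj u v → Adj v u
    irrefl : ∀ {u} → ¬ Adj u u

data Path {V : Set} (E : V → V → Set) : V → V → Set where
  here : ∀ {u} → Path E u u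
  step : ∀ {u v w} → E u v → Path E v w → Path E u w

module _ (G : Graph) where
  open Graph G

  V : Set
  V = Fin n

  Connected : Set
  Connected = ∀ (u v : V) → Path Adj u v

  Cycle4 : V → V → V → V → Set
  Cycle4 u₁ u₂ u₃ u₄ =
    (¬ u₁ ≡ u₂) × (¬ u₁ ≡ u₃) × (¬ u₁ ≡ u₄) ×
    (¬ u₂ ≡ u₃) × (¬ u₂ ≡ u₄) × (¬ u₃ ≡ u₄) ×
    Adj u₁ u₂ × Adj u₂ u₃ × Adj u₃ u₄ × Adj u₄ u₁

  data Step : V × V → V × V → Set where
    flip : ∀ {a b} → Step (a , b) (b , a)
    opp  : ∀ {u₁ u₂ u₃ u₄} → Cycle4 u₁ u₂ u₃ u₄ → Step (u₁ , u₂) (u₄ , u₃)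

  Related : V × V → V × V → Set
  Related = Star Step

  EdgeSet : Set₁
  EdgeSet = V → V → Set

  IsRibbon : EdgeSet → Set
  IsRibbon r = Σ (V × V) λ e →
    (Adj (Data.Product.proj₁ e) (Data.Product.proj₂ e)) ×
    (∀ a b → (r a b → Adj a b × Related e (a , b)) ×
             (Adj a b × Related e (a , b) → r a b))

  Minus : EdgeSet → V → V → Set
  Minus r a b = Adj a b × ¬ r a b

  IsEdgeCut : EdgeSet → Set
  IsEdgeCut r = ∃[ u ] ∃[ v ] ¬ Path (Minus r) u v

  InVr : EdgeSet → V → Set
  InVr r u = ∃[ v ] r u v

  module _ {c ℓ : Level} (A : AbelianGroup c ℓ) where
    open AbelianGroup A renaming (Carrier to P)

    _⊖_ : P → P → P
    y ⊖ x = y ∙ x ⁻¹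

    -- parallelogram placement (into the abelian group A, e.g. ℝ²)
    IsParallelogramPlacement : (V → P) → Set ℓ
    IsParallelogramPlacement ρ =
      (∀ u v → ρ u ≈ ρ v → u ≡ v) ×
      (∀ u₁ u₂ u₃ u₄ → Cycle4 u₁ u₂ u₃ u₄ →
         (ρ u₂ ⊖ ρ u₁) ≈ (ρ u₃ ⊖ ρ u₄))

module Submission where

-- A ribbon edge leads to another by reversal or by passing to the opposite
-- edge of a 4-cycle.  Such steps preserve the edge vector (parallelogram
-- property) and, as we show, the component of G ∖ r of each endpoint.  For the
-- latter, the two "rungs" of the 4-cycle must be edges of G ∖ r: were a rung in
-- r, two consecutive cycle edges would have vectors ±t, collapsing the cycle.
--
-- Given a parallelogram placement, the
-- invariant "runs from X to Y with vector t" then yields the rung fact and, for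
-- the two sides V₁, V₂, that every ribbon edge crosses with one vector t.

open import Defs
open import Level using (Level)
open import Function using (_∘_)
open import Data.Unit using (⊤; tt)
open import Data.Empty using (⊥; ⊥-elim)
open import Data.Product using (Σ; ∃-syntax; _×_; _,_; proj₁; proj₂)
open import Data.Sum using (_⊎_; inj₁; inj₂; swap)
open import Relation.Nullary using (¬_)
open import Relation.Binary.PropositionalEquality using (_≡_; ≢-sym) renaming (sym to ≡-sym)
open import Relation.Binary.Construct.Closure.ReflexiveTransitive
  using (_◅◅_; return; fold; reverse) renaming (ε to ε⋆)
open import Algebra.Bundles using (AbelianGroup)
import Algebra.Properties.AbelianGroup as AbelianGroupProperties

module _ {V : Set} {E : V → V → Set} where

  _++ᵖ_ : ∀ {u v w} → Path E u v → Path E v w → Path E u w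
  here       ++ᵖ q = q
  step e p   ++ᵖ q = step e (p ++ᵖ q)

  reverseᵖ : (∀ {u v} → E u v → E v u) → ∀ {u v} → Path E u v → Path E v u
  reverseᵖ E-sym here       = here
  reverseᵖ E-sym (step e p) = reverseᵖ E-sym p ++ᵖ step (E-sym e) here

module _ (G : Graph) where
  open Graph G using (Adj) renaming (sym to Adj-sym)

  cycle-reverse : ∀ {u₁ u₂ u₃ u₄} → Cycle4 G u₁ u₂ u₃ u₄ → Cycle4 G u₄ u₃ u₂ u₁
  cycle-reverse (n12 , n13 , n14 , n23 , n24 , n34 , a12 , a23 , a34 , a41) =
    ≢-sym n34 , ≢-sym n24 , ≢-sym n14 , ≢-sym n23 , ≢-sym n13 , ≢-sym n12 ,
    Adj-sym a34 , Adj-sym a23 , Adj-sym a12 , Adj-sym a41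

  -- Exchanging u₁ ↔ u₂ and u₃ ↔ u₄ gives a 4-cycle in which the edge u₁u₂ is
  -- still the first edge, but the rungs u₁u₄ and u₂u₃ trade places.
  cycle-swap : ∀ {u₁ u₂ u₃ u₄} → Cycle4 G u₁ u₂ u₃ u₄ → Cycle4 G u₂ u₁ u₄ u₃
  cycle-swap (n12 , n13 , n14 , n23 , n24 , n34 , a12 , a23 , a34 , a41) =
    ≢-sym n12 , n24 , n23 , n14 , n13 , ≢-sym n34 ,
    Adj-sym a12 , Adj-sym a41 , Adj-sym a34 , Adj-sym a23

  step-sym : ∀ {x y} → Step G x y → Step G y x
  step-sym flip    = flip
  step-sym (opp c) = opp (cycle-reverse c)

  related-sym : ∀ {x y} → Related G x y → Related G y x
  related-sym = reverse step-sym

  step-adjacent : ∀ {x y} → Adj (proj₁ x) (proj₂ x) → Step G x y → Adj (proj₁ y) (proj₂ y)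
  step-adjacent ab flip = Adj-sym ab
  step-adjacent _ (opp (_ , _ , _ , _ , _ , _ , _ , _ , a34 , _)) = Adj-sym a34

  module EdgeCut (r : EdgeSet G) (r-sym : ∀ {a b} → r a b → r b a) where

    minus-sym : ∀ {a b} → Minus G r a b → Minus G r b a
    minus-sym (ab , ¬rab) = Adj-sym ab , ¬rab ∘ r-sym

    -- Follow a path of G towards w: either it avoids r, or the first edge of
    -- r on it starts at an endpoint of r, which reaches w by assumption.
    reach-¬¬ : ∀ {w} → (∀ x → InVr G r x → Path (Minus G r) x w) →
      ∀ {x} → Path Adj x w → ¬ ¬ Path (Minus G r) x w
    reach-¬¬ ends here k = k here
    reach-¬¬ ends {x} (step {v = y} xy p) k =
      reach-¬¬ ends p (λ q → k (step (xy , λ rxy → k (ends x (y , rxy))) q))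

    cut-separates : Connected G → IsEdgeCut G r →
      ∀ w → ¬ (∀ x → InVr G r x → Path (Minus G r) x w)
    cut-separates conn (u , v , u↮v) w ends =
      reach-¬¬ ends (conn u w) λ uw →
      reach-¬¬ ends (conn v w) λ vw →
      u↮v (uw ++ᵖ reverseᵖ minus-sym vw)

  module Ribbon (r : EdgeSet G) (rib : IsRibbon G r) where

    OnRibbon : V G × V G → Set
    OnRibbon x = r (proj₁ x) (proj₂ x)

    base : V G × V G
    base = proj₁ rib

    ribbon⇒related : ∀ x → OnRibbon x → Adj (proj₁ x) (proj₂ x) × Related G base x
    ribbon⇒related x = proj₁ (proj₂ (proj₂ rib) (proj₁ x) (proj₂ x))

    related⇒ribbon : ∀ x → Adj (proj₁ x) (proj₂ x) → Related G base x → OnRibbon x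
    related⇒ribbon x adj rel = proj₂ (proj₂ (proj₂ rib) (proj₁ x) (proj₂ x)) (adj , rel)

    base-on-ribbon : OnRibbon base
    base-on-ribbon = related⇒ribbon base (proj₁ (proj₂ rib)) ε⋆

    related-to-base : ∀ {x} → OnRibbon x → Related G base x
    related-to-base {x} = proj₂ ∘ ribbon⇒related x

    ribbon-step : ∀ {x y} → OnRibbon x → Step G x y → OnRibbon y
    ribbon-step {x} {y} rx s =
      related⇒ribbon y (step-adjacent (proj₁ (ribbon⇒related x rx)) s)
                       (related-to-base rx ◅◅ return s)

    ribbon-sym : ∀ {a b} → r a b → r b a
    ribbon-sym rab = ribbon-step rab flip

    opposite-on-ribbon : ∀ {u₁ u₂ u₃ u₄} → r u₁ u₂ → Cycle4 G u₁ u₂ u₃ u₄ → r u₄ u₃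
    opposite-on-ribbon r12 c = ribbon-step r12 (opp c)

    ribbon-induction : ∀ {k} (I : V G × V G → Set k) →
      (∀ {x y} → OnRibbon x → Step G x y → I x → I y) →
      ∀ {x y} → OnRibbon x → OnRibbon y → I x → I y
    ribbon-induction I preserved rx ry =
      along (related-sym (related-to-base rx) ◅◅ related-to-base ry) rx
      where
      along : ∀ {x y} → Related G x y → OnRibbon x → I x → I y
      along = fold (λ x y → OnRibbon x → I x → I y)
        (λ s continue rx ix → continue (ribbon-step rx s) (preserved rx s ix))
        (λ _ ix → ix)

module Placement {c ℓ : Level} (A : AbelianGroup c ℓ) (G : Graph)
  (ρ : V G → AbelianGroup.Carrier A) (placement : IsParallelogramPlacement G A ρ)
  (r : EdgeSet G) (rib : IsRibbon G r) where

  open Graph G using () renaming (sym to Adj-sym)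
  open AbelianGroup A renaming (Carrier to P)
  open AbelianGroupProperties A using (⁻¹-anti-homo‿-; ⁻¹-injective; ∙-cancelˡ; //-rightDividesˡ)
  open Ribbon G r rib public

  ρ-injective : ∀ {u v} → ρ u ≈ ρ v → u ≡ v
  ρ-injective = proj₁ placement _ _

  parallelogram : ∀ {u₁ u₂ u₃ u₄} → Cycle4 G u₁ u₂ u₃ u₄ → ρ u₂ - ρ u₁ ≈ ρ u₃ - ρ u₄
  parallelogram = proj₂ placement _ _ _ _

  parallelogram-reversed : ∀ {u₁ u₂ u₃ u₄} → Cycle4 G u₁ u₂ u₃ u₄ →
    ρ u₁ - ρ u₂ ≈ ρ u₄ - ρ u₃
  parallelogram-reversed {u₁} {u₂} {u₃} {u₄} c = begin
    ρ u₁ - ρ u₂        ≈⟨ ⁻¹-anti-homo‿- (ρ u₂) (ρ u₁) ⟨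
    (ρ u₂ - ρ u₁) ⁻¹   ≈⟨ ⁻¹-cong (parallelogram c) ⟩
    (ρ u₃ - ρ u₄) ⁻¹   ≈⟨ ⁻¹-anti-homo‿- (ρ u₃) (ρ u₄) ⟩
    ρ u₄ - ρ u₃        ∎
    where open import Relation.Binary.Reasoning.Setoid setoid

  -‿cancelˡ : ∀ {x y z} → z - x ≈ z - y → x ≈ y
  -‿cancelˡ {z = z} e = ⁻¹-injective (∙-cancelˡ z _ _ e)

  difference⇒translate : ∀ {x y t} → x - y ≈ t → x ≈ y ∙ t
  difference⇒translate {x} {y} {t} e =
    trans (sym (//-rightDividesˡ y x)) (trans (∙-congʳ e) (comm t y))

  RungClosed : (V G → Set) → Set
  RungClosed X = ∀ {u₁ u₂ u₃ u₄} → r u₁ u₂ → Cycle4 G u₁ u₂ u₃ u₄ → X u₁ → X u₄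

  -- The other rung u₂u₃ is the first rung of the swapped cycle.
  other-rung : ∀ {X} → RungClosed X →
    ∀ {u₁ u₂ u₃ u₄} → r u₁ u₂ → Cycle4 G u₁ u₂ u₃ u₄ → X u₂ → X u₃
  other-rung closed r12 c = closed (ribbon-sym r12) (cycle-swap G c)

  Oriented : (X Y : V G → Set) → P → V G × V G → Set ℓ
  Oriented X Y t (a , b) = (X a × Y b × ρ b - ρ a ≈ t) ⊎ (Y a × X b × ρ a - ρ b ≈ t)

  oriented-ribbon : ∀ {X Y t} → RungClosed X → RungClosed Y →
    ∀ {x y} → OnRibbon x → OnRibbon y → Oriented X Y t x → Oriented X Y t y
  oriented-ribbon {X} {Y} {t} X-closed Y-closed = ribbon-induction (Oriented X Y t) preserved
    where
    preserved : ∀ {x y} → OnRibbon x → Step G x y → Oriented X Y t x → Oriented X Y t y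
    preserved _ flip (inj₁ (xa , yb , d)) = inj₂ (yb , xa , d)
    preserved _ flip (inj₂ (ya , xb , d)) = inj₁ (xb , ya , d)
    preserved r12 (opp c) (inj₁ (x1 , y2 , d)) =
      inj₁ (X-closed r12 c x1 , other-rung Y-closed r12 c y2 , trans (sym (parallelogram c)) d)
    preserved r12 (opp c) (inj₂ (y1 , x2 , d)) =
      inj₂ (Y-closed r12 c y1 , other-rung X-closed r12 c x2 ,
            trans (sym (parallelogram-reversed c)) d)

  -- Two consecutive edges of a 4-cycle never lie in the same ribbon: their
  -- vectors would agree up to sign, forcing u₂ = u₄ or u₁ = u₃.
  no-consecutive : ∀ {u₁ u₂ u₃ u₄} → Cycle4 G u₁ u₂ u₃ u₄ → r u₁ u₂ → ¬ r u₂ u₃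
  no-consecutive c@(_ , n13 , _ , _ , n24 , _) r12 r23
    with oriented-ribbon {X = λ _ → ⊤} {Y = λ _ → ⊤} (λ _ _ _ → tt) (λ _ _ _ → tt)
           r12 r23 (inj₁ (tt , tt , refl))
  ... | inj₁ (_ , _ , d) = n24 (ρ-injective (-‿cancelˡ (trans d (parallelogram c))))
  ... | inj₂ (_ , _ , d) = n13 (≡-sym (ρ-injective (-‿cancelˡ d)))

  rung-outside : ∀ {u₁ u₂ u₃ u₄} → r u₁ u₂ → Cycle4 G u₁ u₂ u₃ u₄ → Minus G r u₁ u₄
  rung-outside r12 c@(_ , _ , _ , _ , _ , _ , _ , _ , _ , a41) =
    Adj-sym a41 , no-consecutive (cycle-swap G c) (ribbon-sym r12)

  side-closed : ∀ {X Y : V G → Set} → (∀ x → InVr G r x → X x ⊎ Y x) →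
    (∀ {u v} → X u → Y v → ¬ Path (Minus G r) u v) → RungClosed X
  side-closed cover apart r12 c x1 with cover _ (_ , opposite-on-ribbon r12 c)
  ... | inj₁ x4 = x4
  ... | inj₂ y4 = ⊥-elim (apart x1 y4 (step (rung-outside r12 c) here))

  one-sided : ∀ {X} → RungClosed X → ∀ {a b} → r a b → X a → X b →
    ∀ x → InVr G r x → X x
  one-sided closed {a} {b} rab xa xb x (y , rxy)
    with oriented-ribbon {t = ρ b - ρ a} closed closed rab rxy (inj₁ (xa , xb , refl))
  ... | inj₁ (xx , _ , _) = xx
  ... | inj₂ (xx , _ , _) = xx

module Sides {c ℓ : Level} (A : AbelianGroup c ℓ) (G : Graph) (conn : Connected G)
  (ρ : V G → AbelianGroup.Carrier A) (placement : IsParallelogramPlacement G A ρ)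
  (r : EdgeSet G) (rib : IsRibbon G r) (cut : IsEdgeCut G r)
  (V₁ V₂ : V G → Set)
  (cover : ∀ u → InVr G r u → V₁ u ⊎ V₂ u)
  (on-ribbon : ∀ u → V₁ u ⊎ V₂ u → InVr G r u)
  (V₁-connected : ∀ u v → V₁ u → V₁ v → Path (Minus G r) u v)
  (V₂-connected : ∀ u v → V₂ u → V₂ v → Path (Minus G r) u v) where

  open AbelianGroup A renaming (Carrier to P)
  open Placement A G ρ placement r rib
  open EdgeCut G r ribbon-sym

  -- A class of ribbon endpoints that is connected in G ∖ r and rung-closed
  -- cannot contain both ends of a ribbon edge: it would contain all ribbon
  -- endpoints, contradicting that r is a cut.
  not-one-sided : ∀ {X} → RungClosed X → (∀ u v → X u → X v → Path (Minus G r) u v) →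
    ∀ {a b} → r a b → X a → X b → ⊥
  not-one-sided closed connected {a} rab xa xb = cut-separates conn cut a λ x ix →
    connected x a (one-sided closed rab xa xb x ix) xa

  sides-apart : ∀ {u v} → V₁ u → V₂ v → ¬ Path (Minus G r) u v
  sides-apart {u} v1 v2 p = cut-separates conn cut u λ x ix → joined x (cover x ix)
    where
    joined : ∀ x → V₁ x ⊎ V₂ x → Path (Minus G r) x u
    joined x (inj₁ x1) = V₁-connected x u x1 v1
    joined x (inj₂ x2) = V₂-connected x _ x2 v2 ++ᵖ reverseᵖ minus-sym p

  sides-disjoint : ∀ {u} → V₁ u → ¬ V₂ u
  sides-disjoint v1 v2 = sides-apart v1 v2 here

  V₁-closed : RungClosed V₁
  V₁-closed = side-closed cover sides-apart

  V₂-closed : RungClosed V₂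
  V₂-closed = side-closed (λ x → swap ∘ cover x) λ v2 v1 → sides-apart v1 v2 ∘ reverseᵖ minus-sym

  base-crossing : Σ P λ t → Oriented V₁ V₂ t base
  base-crossing with cover _ (_ , base-on-ribbon) | cover _ (_ , ribbon-sym base-on-ribbon)
  ... | inj₁ va | inj₁ vb = ⊥-elim (not-one-sided V₁-closed V₁-connected base-on-ribbon va vb)
  ... | inj₂ va | inj₂ vb = ⊥-elim (not-one-sided V₂-closed V₂-connected base-on-ribbon va vb)
  ... | inj₁ va | inj₂ vb = _ , inj₁ (va , vb , refl)
  ... | inj₂ va | inj₁ vb = _ , inj₂ (va , vb , refl)

  crossing-vector : P
  crossing-vector = proj₁ base-crossing

  every-edge-crosses : ∀ {a b} → r a b → Oriented V₁ V₂ crossing-vector (a , b)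
  every-edge-crosses rab = oriented-ribbon V₁-closed V₂-closed base-on-ribbon rab (proj₂ base-crossing)

  V₂-translate-of-V₁ : ∀ u → V₂ u → ∃[ w ] (V₁ w × ρ u ≈ ρ w ∙ crossing-vector)
  V₂-translate-of-V₁ u v2 with on-ribbon u (inj₂ v2)
  ... | w , ruw with every-edge-crosses ruw
  ...   | inj₁ (v1 , _ , _)  = ⊥-elim (sides-disjoint v1 v2)
  ...   | inj₂ (_ , w1 , d) = w , w1 , difference⇒translate d

  V₁-translate-to-V₂ : ∀ w → V₁ w → ∃[ u ] (V₂ u × ρ u ≈ ρ w ∙ crossing-vector)
  V₁-translate-to-V₂ w v1 with on-ribbon w (inj₁ v1)
  ... | u , rwu with every-edge-crosses rwu
  ...   | inj₁ (_ , u2 , d) = u , u2 , difference⇒translate d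
  ...   | inj₂ (v2 , _ , _)  = ⊥-elim (sides-disjoint v1 v2)

  crossing-edge-vector : ∀ u₁ u₂ → r u₁ u₂ → V₁ u₁ → V₂ u₂ → ρ u₂ - ρ u₁ ≈ crossing-vector
  crossing-edge-vector u₁ u₂ r12 v1 _ with every-edge-crosses r12
  ... | inj₁ (_ , _ , d)  = d
  ... | inj₂ (v2 , _ , _) = ⊥-elim (sides-disjoint v1 v2)

lemma3p6 : {c ℓ : Level} (A : AbelianGroup c ℓ) (G : Graph) →
    Connected G →
    (ρ : V G → AbelianGroup.Carrier A) →
    IsParallelogramPlacement G A ρ →
    (r : EdgeSet G) → IsRibbon G r → IsEdgeCut G r →
    (V₁ V₂ : V G → Set) →
    (∀ u → InVr G r u → V₁ u ⊎ V₂ u) →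
    (∀ u → V₁ u ⊎ V₂ u → InVr G r u) →
    (∀ u v → V₁ u → V₁ v → Path (Minus G r) u v) →
    (∀ u v → V₂ u → V₂ v → Path (Minus G r) u v) →
    Σ (AbelianGroup.Carrier A) λ t →
    (∀ u → V₂ u → ∃[ w ] (V₁ w ×
    AbelianGroup._≈_ A (ρ u) (AbelianGroup._∙_ A (ρ w) t))) ×
    (∀ w → V₁ w → ∃[ u ] (V₂ u ×
    AbelianGroup._≈_ A (ρ u) (AbelianGroup._∙_ A (ρ w) t))) ×
    (∀ u₁ u₂ → r u₁ u₂ → V₁ u₁ → V₂ u₂ →
    AbelianGroup._≈_ A (_⊖_ G A (ρ u₂) (ρ u₁)) t)
lemma3p6 A G conn ρ placement r rib cut V₁ V₂ cover on-ribbon V₁-connected V₂-connected =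
  crossing-vector , V₂-translate-of-V₁ , V₁-translate-to-V₂ , crossing-edge-vector
  where
  open Sides A G conn ρ placement r rib cut V₁ V₂ cover on-ribbon V₁-connected V₂-connected
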